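{- Let $n\ge 1$ be an integer and let $M(P_n)$ be the middle graph of the path $P_n$ on $n$ vertices. Then $$\operatorname{rn}(M(P_n))\le\begin{cases}4k^2-1, & \text{if } n=2k,\\ 4k(k+1), & \text{if } n=2k+1.\end{cases}$$
   Context: For a graph $G$, the middle graph $M(G)$ is the graph with vertex set $V(G)\cup E(G)$ in which two vertices are adjacent if and only if either they are adjacent edges of $G$, or one is a vertex of $G$ and the other is an edge of $G$ incident to it. For a connected graph $G$ with diameter $\operatorname{diam}(G)$ and distance function $d(u,v)$, a radio labeling of $G$ is a map $\varphi:V(G)\to\{0,1,2,\dots\}$ such that $|\varphi(u)-\varphi(v)|\ge \operatorname{diam}(G)+1-d(u,v)$ for every pair of distinct vertices $u,v$. The span of $\varphi$ is $\max\{|\varphi(u)-\varphi(v)|: u,v\in V(G)\}$, and the radio number $\operatorname{rn}(G)$ is the minimum span over all radio labelings of $G$. -}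

module Defs where

open import Data.Nat using (ℕ; zero; suc; _+_; _*_; _∸_; _≤_; ∣_-_∣)
open import Data.Fin using (Fin; toℕ)
open import Data.Sum using (_⊎_; inj₁; inj₂)
open import Data.Product using (Σ; ∃; ∃-syntax; _×_; _,_)
open import Data.Empty using (⊥)
open import Relation.Nullary using (¬_)
open import Relation.Binary.PropositionalEquality using (_≡_)

record Graph : Set₁ where
  field
    Vtx : Set
    Adj : Vtx → Vtx → Set
open Graph public

record IncidenceGraph : Set₁ where
  field
    V   : Set
    E   : Set
    Inc : V → E → Set
open IncidenceGraph public

MAdj : (G : IncidenceGraph) → V G ⊎ E G → V G ⊎ E G → Set
MAdj G (inj₁ v) (inj₁ w) = ⊥
MAdj G (inj₁ v) (inj₂ e) = Inc G v e
MAdj G (inj₂ e) (inj₁ v) = Inc G v e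
MAdj G (inj₂ e) (inj₂ f) = (¬ e ≡ f) × (∃[ v ] (Inc G v e × Inc G v f))

Middle : IncidenceGraph → Graph
Middle G = record { Vtx = V G ⊎ E G ; Adj = MAdj G }

Path : ℕ → IncidenceGraph
Path n = record
  { V = Fin n
  ; E = Fin (n ∸ 1)
  ; Inc = λ i j → (toℕ i ≡ toℕ j) ⊎ (toℕ i ≡ suc (toℕ j))
  }

data Walk (G : Graph) : Vtx G → Vtx G → ℕ → Set where
  [] : ∀ {u} → Walk G u u zero
  _∷_ : ∀ {u w v k} → Adj G u w → Walk G w v k → Walk G u v (suc k)

IsDist : (G : Graph) → Vtx G → Vtx G → ℕ → Set
IsDist G u v k = Walk G u v k × (∀ k' → Walk G u v k' → k ≤ k')

IsDiam : (G : Graph) → ℕ → Set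
IsDiam G D = (∀ u v → ∃[ k ] (IsDist G u v k × k ≤ D))
           × (∃[ u ] ∃[ v ] IsDist G u v D)

IsRadioLabeling : (G : Graph) → (Vtx G → ℕ) → Set
IsRadioLabeling G φ =
  ∀ D → IsDiam G D → ∀ u v → ¬ u ≡ v → ∀ k → IsDist G u v k →
  D + 1 ≤ ∣ φ u - φ v ∣ + k

SpanAtMost : (G : Graph) → (Vtx G → ℕ) → ℕ → Set
SpanAtMost G φ b = ∀ u v → ∣ φ u - φ v ∣ ≤ b

-- rn(G) ≤ b: since rn(G) is the minimum span over all radio labelings,
-- this holds iff some radio labeling has span at most b.
RnAtMost : Graph → ℕ → Set
RnAtMost G b = Σ (Vtx G → ℕ) λ φ → IsRadioLabeling G φ × SpanAtMost G φ b

module Submission where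

-- Put vertex i of P_n at position 2i and the edge {i, i+1} at 2i+1, and give the
-- vertices of P_n weight 1 and its edges weight 0.  Along an edge of M(P_n) the
-- position changes by at most 2 minus the weights of the two ends, so
-- 2 d(u,v) ≥ |pos u − pos v| + wt u + wt v; routing through the edges of P_n
-- shows diam ≤ n.  With n = m + 1, visit the positions in the order
-- m, m+1, 0, m+2, 1, m+3, 2, … and label them by partial sums of the gaps
-- n, a, b, c, d, a, b, c, d, …: each gap plus the distance between its two ends
-- is n + 1, and any two successive gaps add up to at least n, which settles the
-- radio condition for consecutive and for non-consecutive vertices respectively.
-- The span is the last partial sum.

open import Defs
open import Data.Nat using (ℕ; zero; suc; pred; _+_; _*_; _∸_; _≤_; _<_; _≤′_; ≤′-refl; ≤′-step; z≤n; s≤s; ∣_-_∣; compare; less; equal; greater)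
open import Data.Nat.Properties
open import Data.Nat.Tactic.RingSolver using (solve-∀; solve)
open import Data.Fin using (Fin; toℕ; fromℕ<) renaming (zero to fzero; suc to fsuc)
open import Data.Fin.Properties using (toℕ-injective; toℕ<n; toℕ≤pred[n]; toℕ-fromℕ<)
open import Data.List using ([_])
open import Data.Sum using (_⊎_; inj₁; inj₂)
open import Data.Product using (∃-syntax; _×_; _,_)
open import Function using (_∘_)
open import Relation.Nullary using (contradiction)
open import Relation.Binary using (tri<; tri≈; tri>)
open import Relation.Binary.PropositionalEquality using (_≡_; _≢_; refl; sym; trans; cong; cong₂; subst; subst₂; module ≡-Reasoning)

partialSum : (ℕ → ℕ) → ℕ → ℕ
partialSum f zero    = 0
partialSum f (suc t) = partialSum f t + f t

module _ (f : ℕ → ℕ) where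

  partialSum-mono : ∀ {t s} → t ≤ s → partialSum f t ≤ partialSum f s
  partialSum-mono = mono′ ∘ ≤⇒≤′
    where
    mono′ : ∀ {t s} → t ≤′ s → partialSum f t ≤ partialSum f s
    mono′ ≤′-refl      = ≤-refl
    mono′ (≤′-step le) = ≤-trans (mono′ le) (m≤m+n _ _)

  ∣partialSum-suc∣ : ∀ t → ∣ partialSum f t - partialSum f (suc t) ∣ ≡ f t
  ∣partialSum-suc∣ t = ∣m-m+n∣≡n (partialSum f t) (f t)

  partialSum-spread : ∀ {t s} → suc (suc t) ≤ s → f t + f (suc t) ≤ ∣ partialSum f t - partialSum f s ∣
  partialSum-spread {t} {s} le = begin
    f t + f (suc t)                                       ≡⟨ m+n∸m≡n (partialSum f t) _ ⟨
    partialSum f t + (f t + f (suc t)) ∸ partialSum f t   ≡⟨ cong (_∸ partialSum f t) (+-assoc (partialSum f t) _ _) ⟨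
    partialSum f (suc (suc t)) ∸ partialSum f t           ≤⟨ ∸-monoˡ-≤ (partialSum f t) (partialSum-mono le) ⟩
    partialSum f s ∸ partialSum f t                       ≤⟨ m∸n≤∣m-n∣ (partialSum f s) (partialSum f t) ⟩
    ∣ partialSum f s - partialSum f t ∣                   ≡⟨ ∣-∣-comm (partialSum f s) (partialSum f t) ⟩
    ∣ partialSum f t - partialSum f s ∣                   ∎
    where open ≤-Reasoning

  ∣partialSum-partialSum∣≤ : ∀ {t s N} → t ≤ N → s ≤ N → ∣ partialSum f t - partialSum f s ∣ ≤ partialSum f N
  ∣partialSum-partialSum∣≤ {t} {s} t≤N s≤N =
    ≤-trans (∣m-n∣≤m⊔n (partialSum f t) (partialSum f s)) (⊔-lub (partialSum-mono t≤N) (partialSum-mono s≤N))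

  partialSum-+ : ∀ a b → partialSum f (a + b) ≡ partialSum f a + partialSum (λ i → f (a + i)) b
  partialSum-+ a zero    = trans (cong (partialSum f) (+-identityʳ a)) (sym (+-identityʳ _))
  partialSum-+ a (suc b) = begin
    partialSum f (a + suc b)                                          ≡⟨ cong (partialSum f) (+-suc a b) ⟩
    partialSum f (a + b) + f (a + b)                                  ≡⟨ cong (_+ f (a + b)) (partialSum-+ a b) ⟩
    partialSum f a + partialSum (λ i → f (a + i)) b + f (a + b)       ≡⟨ +-assoc (partialSum f a) _ _ ⟩
    partialSum f a + partialSum (λ i → f (a + i)) (suc b)             ∎
    where open ≡-Reasoning

partialSum-cong : ∀ {f g} → (∀ t → f t ≡ g t) → ∀ t → partialSum f t ≡ partialSum g t
partialSum-cong f≗g zero    = refl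
partialSum-cong f≗g (suc t) = cong₂ _+_ (partialSum-cong f≗g t) (f≗g t)

partialSum-periodic : ∀ f p → (∀ t → f (p + t) ≡ f t) →
                      ∀ q r → partialSum f (q * p + r) ≡ q * partialSum f p + partialSum f r
partialSum-periodic f p periodic zero    r = refl
partialSum-periodic f p periodic (suc q) r = begin
  partialSum f (p + q * p + r)                                ≡⟨ cong (partialSum f) (+-assoc p (q * p) r) ⟩
  partialSum f (p + (q * p + r))                              ≡⟨ partialSum-+ f p (q * p + r) ⟩
  partialSum f p + partialSum (λ i → f (p + i)) (q * p + r)   ≡⟨ cong (partialSum f p +_) (partialSum-cong periodic (q * p + r)) ⟩
  partialSum f p + partialSum f (q * p + r)                   ≡⟨ cong (partialSum f p +_) (partialSum-periodic f p periodic q r) ⟩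
  partialSum f p + (q * partialSum f p + partialSum f r)      ≡⟨ +-assoc (partialSum f p) _ _ ⟨
  suc q * partialSum f p + partialSum f r                     ∎
  where open ≡-Reasoning

cycle₄ : ℕ → ℕ → ℕ → ℕ → ℕ → ℕ
cycle₄ a b c d 0 = a
cycle₄ a b c d 1 = b
cycle₄ a b c d 2 = c
cycle₄ a b c d 3 = d
cycle₄ a b c d (suc (suc (suc (suc t)))) = cycle₄ a b c d t

cycle₄-pair≥ : ∀ {N a b c d} → N ≤ a + b → N ≤ b + c → N ≤ c + d → N ≤ d + a →
               ∀ t → N ≤ cycle₄ a b c d t + cycle₄ a b c d (suc t)
cycle₄-pair≥ ab bc cd da 0 = ab
cycle₄-pair≥ ab bc cd da 1 = bc
cycle₄-pair≥ ab bc cd da 2 = cd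
cycle₄-pair≥ ab bc cd da 3 = da
cycle₄-pair≥ ab bc cd da (suc (suc (suc (suc t)))) = cycle₄-pair≥ ab bc cd da t

partialSum-cycle₄ : ∀ a b c d q r →
                    partialSum (cycle₄ a b c d) (q * 4 + r) ≡ q * (a + b + c + d) + partialSum (cycle₄ a b c d) r
partialSum-cycle₄ a b c d = partialSum-periodic (cycle₄ a b c d) 4 (λ _ → refl)

∣-∣-weighted-triangle : ∀ x y z a b c → ∣ x - z ∣ + a + c ≤ (∣ x - y ∣ + a + b) + (∣ y - z ∣ + b + c)
∣-∣-weighted-triangle x y z a b c = begin
  ∣ x - z ∣ + a + c                                 ≤⟨ +-monoˡ-≤ c (+-monoˡ-≤ a (∣-∣-triangle x y z)) ⟩
  ∣ x - y ∣ + ∣ y - z ∣ + a + c                     ≤⟨ m≤m+n _ (b + b) ⟩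
  ∣ x - y ∣ + ∣ y - z ∣ + a + c + (b + b)           ≡⟨ rearrange ∣ x - y ∣ ∣ y - z ∣ a b c ⟩
  (∣ x - y ∣ + a + b) + (∣ y - z ∣ + b + c)         ∎
  where
  open ≤-Reasoning
  rearrange : ∀ d e a b c → d + e + a + c + (b + b) ≡ (d + a + b) + (e + b + c)
  rearrange = solve-∀

half-≤ : ∀ g B {N x} → N * 2 ≡ g * 2 + B → B ≤ x * 2 → N ≤ g + x
half-≤ g B {N} {x} eq B≤ = *-cancelʳ-≤ N (g + x) 2 (begin
  N * 2          ≡⟨ eq ⟩
  g * 2 + B      ≤⟨ +-monoʳ-≤ (g * 2) B≤ ⟩
  g * 2 + x * 2  ≡⟨ *-distribʳ-+ 2 g x ⟨
  (g + x) * 2    ∎)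
  where open ≤-Reasoning

module _ {G : Graph} where

  _∷ʳ_ : ∀ {u w v k} → Walk G u w k → Adj G w v → Walk G u v (suc k)
  []      ∷ʳ a = a ∷ []
  (b ∷ p) ∷ʳ a = b ∷ (p ∷ʳ a)

  _++ʷ_ : ∀ {u w v k l} → Walk G u w k → Walk G w v l → Walk G u v (k + l)
  []      ++ʷ q = q
  (a ∷ p) ++ʷ q = a ∷ (p ++ʷ q)

  reverseʷ : (∀ {u v} → Adj G u v → Adj G v u) → ∀ {u v k} → Walk G u v k → Walk G v u k
  reverseʷ adj-sym []      = []
  reverseʷ adj-sym (a ∷ p) = reverseʷ adj-sym p ∷ʳ adj-sym a

  walk-bound : (pos wt : Vtx G → ℕ) {c : ℕ} →
               (∀ {u v} → Adj G u v → ∣ pos u - pos v ∣ + wt u + wt v ≤ c) →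
               ∀ {u v k} → Walk G u v (suc k) → ∣ pos u - pos v ∣ + wt u + wt v ≤ suc k * c
  walk-bound pos wt {c} step (a ∷ []) = subst (_ ≤_) (sym (+-identityʳ c)) (step a)
  walk-bound pos wt {c} step {u} {v} (_∷_ {w = x} a p@(_ ∷ _)) =
    ≤-trans (∣-∣-weighted-triangle (pos u) (pos x) (pos v) (wt u) (wt x) (wt v))
            (+-mono-≤ (step a) (walk-bound pos wt step p))

  diam≤ : ∀ {B} → (∀ u v → ∃[ k ] (k ≤ B × Walk G u v k)) → ∀ {D} → IsDiam G D → D ≤ B
  diam≤ walks (_ , u , v , _ , minimal) with walks u v
  ... | k , k≤B , p = ≤-trans (minimal k p) k≤B

module _ {G : Graph} (adj-sym : ∀ {u v} → Adj G u v → Adj G v u)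
         {D₀ : ℕ} (diam≤D₀ : ∀ {D} → IsDiam G D → D ≤ D₀)
         (ord : Vtx G → ℕ) (ord-injective : ∀ {u v} → ord u ≡ ord v → u ≡ v)
         (gap : ℕ → ℕ) (gap-pair : ∀ t → D₀ ≤ gap t + gap (suc t))
         (gap-step : ∀ {u v k} → suc (ord u) ≡ ord v → Walk G u v (suc k) → D₀ + 1 ≤ gap (ord u) + suc k)
  where

  private
    φ : Vtx G → ℕ
    φ = partialSum gap ∘ ord

    radio-ordered : ∀ {u v k} → ord u < ord v → Walk G u v (suc k) → D₀ + 1 ≤ ∣ φ u - φ v ∣ + suc k
    radio-ordered {u} {v} {k} lt p with m≤n⇒m<n∨m≡n lt
    ... | inj₁ far  = +-mono-≤ (≤-trans (gap-pair (ord u)) (partialSum-spread gap far)) (s≤s z≤n)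
    ... | inj₂ next =
      subst (λ s → D₀ + 1 ≤ ∣ φ u - partialSum gap s ∣ + suc k) next
        (subst (λ g → D₀ + 1 ≤ g + suc k) (sym (∣partialSum-suc∣ gap (ord u))) (gap-step next p))

  radio-from-ordering : IsRadioLabeling G (partialSum gap ∘ ord)
  radio-from-ordering D diam u v u≢v zero    ([] , _) = contradiction refl u≢v
  radio-from-ordering D diam u v u≢v (suc k) (p , _) = ≤-trans (+-monoˡ-≤ 1 (diam≤D₀ diam)) bound
    where
    bound : D₀ + 1 ≤ ∣ φ u - φ v ∣ + suc k
    bound with <-cmp (ord u) (ord v)
    ... | tri< lt _ _ = radio-ordered lt p
    ... | tri≈ _ eq _ = contradiction (ord-injective eq) u≢v
    ... | tri> _ _ gt =
      subst (λ d → D₀ + 1 ≤ d + suc k) (∣-∣-comm (φ v) (φ u)) (radio-ordered gt (reverseʷ adj-sym p))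

Middle-adj-sym : ∀ G {u v} → Adj (Middle G) u v → Adj (Middle G) v u
Middle-adj-sym G {inj₁ _} {inj₁ _} ()
Middle-adj-sym G {inj₁ _} {inj₂ _} inc = inc
Middle-adj-sym G {inj₂ _} {inj₁ _} inc = inc
Middle-adj-sym G {inj₂ _} {inj₂ _} (e≢f , x , x∈e , x∈f) = e≢f ∘ sym , x , x∈f , x∈e

Middle-reverse : ∀ {G u v k} → Walk (Middle G) u v k → Walk (Middle G) v u k
Middle-reverse {G} = reverseʷ (λ {u} {v} → Middle-adj-sym G {u} {v})

evenBit : ℕ → ℕ
evenBit 0             = 1
evenBit 1             = 0
evenBit (suc (suc n)) = evenBit n

evenBit-even : ∀ n → evenBit (2 * n) ≡ 1
evenBit-even zero    = refl
evenBit-even (suc n) = trans (cong evenBit (*-suc 2 n)) (evenBit-even n)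

evenBit-odd : ∀ n → evenBit (suc (2 * n)) ≡ 0
evenBit-odd zero    = refl
evenBit-odd (suc n) = trans (cong (evenBit ∘ suc) (*-suc 2 n)) (evenBit-odd n)

2*≢1+2* : ∀ a b → 2 * a ≢ suc (2 * b)
2*≢1+2* a b eq with trans (sym (evenBit-even a)) (trans (cong evenBit eq) (evenBit-odd b))
... | ()

∣2*-1+2*∣≡1 : ∀ {a b} → a ≡ b ⊎ a ≡ suc b → ∣ 2 * a - suc (2 * b) ∣ ≡ 1
∣2*-1+2*∣≡1 {b = b} (inj₁ refl) = trans (cong (∣ 2 * b -_∣) (+-comm 1 (2 * b))) (∣m-m+n∣≡n (2 * b) 1)
∣2*-1+2*∣≡1 {b = b} (inj₂ refl) = begin
  ∣ 2 * suc b - suc (2 * b) ∣   ≡⟨ cong (∣_- suc (2 * b) ∣) (*-suc 2 b) ⟩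
  ∣ suc (2 * b) - 2 * b ∣       ≡⟨ ∣-∣-comm (suc (2 * b)) (2 * b) ⟩
  ∣ 2 * b - suc (2 * b) ∣       ≡⟨ ∣2*-1+2*∣≡1 {b} (inj₁ refl) ⟩
  1                             ∎
  where open ≡-Reasoning

module _ {n : ℕ} where

  private
    G : Graph
    G = Middle (Path n)

  pos : Vtx G → ℕ
  pos (inj₁ i) = 2 * toℕ i
  pos (inj₂ j) = suc (2 * toℕ j)

  pos-injective : ∀ {u v} → pos u ≡ pos v → u ≡ v
  pos-injective {inj₁ i} {inj₁ i′} eq = cong inj₁ (toℕ-injective (*-cancelˡ-≡ _ _ 2 eq))
  pos-injective {inj₁ i} {inj₂ j}  eq = contradiction eq (2*≢1+2* (toℕ i) (toℕ j))
  pos-injective {inj₂ j} {inj₁ i}  eq = contradiction (sym eq) (2*≢1+2* (toℕ i) (toℕ j))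
  pos-injective {inj₂ j} {inj₂ j′} eq = cong inj₂ (toℕ-injective (*-cancelˡ-≡ _ _ 2 (suc-injective eq)))

  adj-pos-bound : ∀ {u v} → Adj G u v → ∣ pos u - pos v ∣ + evenBit (pos u) + evenBit (pos v) ≤ 2
  adj-pos-bound {inj₁ i} {inj₂ j} i∈j
    rewrite evenBit-even (toℕ i) | evenBit-odd (toℕ j) | ∣2*-1+2*∣≡1 i∈j = ≤-refl
  adj-pos-bound {inj₂ j} {inj₁ i} i∈j
    rewrite evenBit-even (toℕ i) | evenBit-odd (toℕ j)
          | ∣-∣-comm (suc (2 * toℕ j)) (2 * toℕ i) | ∣2*-1+2*∣≡1 i∈j = ≤-refl
  adj-pos-bound {inj₂ j} {inj₂ j′} (_ , x , x∈j , x∈j′)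
    rewrite evenBit-odd (toℕ j) | evenBit-odd (toℕ j′) = begin
    ∣ pos (inj₂ j) - pos (inj₂ j′) ∣ + 0 + 0                              ≡⟨ trans (+-identityʳ _) (+-identityʳ _) ⟩
    ∣ pos (inj₂ j) - pos (inj₂ j′) ∣                                      ≤⟨ ∣-∣-triangle (pos (inj₂ j)) (pos (inj₁ x)) (pos (inj₂ j′)) ⟩
    ∣ pos (inj₂ j) - pos (inj₁ x) ∣ + ∣ pos (inj₁ x) - pos (inj₂ j′) ∣    ≡⟨ cong₂ _+_ x∈j-gap (∣2*-1+2*∣≡1 x∈j′) ⟩
    2                                                                     ∎
    where
    open ≤-Reasoning
    x∈j-gap : ∣ pos (inj₂ j) - pos (inj₁ x) ∣ ≡ 1
    x∈j-gap = trans (∣-∣-comm (pos (inj₂ j)) (pos (inj₁ x))) (∣2*-1+2*∣≡1 x∈j)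

edge-walk : ∀ {m} d (j j′ : Fin m) → toℕ j + d ≡ toℕ j′ → Walk (Middle (Path (suc m))) (inj₂ j) (inj₂ j′) d
edge-walk zero j j′ eq with toℕ-injective {i = j} {j = j′} (trans (sym (+-identityʳ (toℕ j))) eq)
... | refl = []
edge-walk {m} (suc d) j j′ eq = j~next ∷ edge-walk d next j′ next+d≡j′
  where
  eq′ : suc (toℕ j + d) ≡ toℕ j′
  eq′ = trans (sym (+-suc (toℕ j) d)) eq
  next<m : suc (toℕ j) < m
  next<m = ≤-trans (s≤s (s≤s (m≤m+n (toℕ j) d))) (subst (_< m) (sym eq′) (toℕ<n j′))
  next : Fin m
  next = fromℕ< next<m
  next+d≡j′ : toℕ next + d ≡ toℕ j′
  next+d≡j′ = trans (cong (_+ d) (toℕ-fromℕ< next<m)) eq′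
  j~next : Adj (Middle (Path (suc m))) (inj₂ j) (inj₂ next)
  j~next = (λ j≡next → 1+n≢n (sym (trans (cong toℕ j≡next) (toℕ-fromℕ< next<m))))
         , fsuc j , inj₂ refl , inj₁ (sym (toℕ-fromℕ< next<m))

edges-walk : ∀ {m} (j j′ : Fin m) → ∃[ k ] (k ≤ pred m × Walk (Middle (Path (suc m))) (inj₂ j) (inj₂ j′) k)
edges-walk {m} j j′ with ≤-total (toℕ j) (toℕ j′)
... | inj₁ j≤j′ = _ , ≤-trans (m∸n≤m (toℕ j′) (toℕ j)) (toℕ≤pred[n] j′) , edge-walk _ j j′ (m+[n∸m]≡n j≤j′)
... | inj₂ j′≤j = _ , ≤-trans (m∸n≤m (toℕ j) (toℕ j′)) (toℕ≤pred[n] j)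
                , Middle-reverse (edge-walk _ j′ j (m+[n∸m]≡n j′≤j))

to-edge : ∀ {m} (u : Vtx (Middle (Path (suc (suc m))))) → ∃[ j ] ∃[ l ] (l ≤ 1 × Walk (Middle (Path (suc (suc m)))) u (inj₂ j) l)
to-edge (inj₁ fzero)    = fzero , 1 , ≤-refl , inj₁ refl ∷ []
to-edge (inj₁ (fsuc i)) = i , 1 , ≤-refl , inj₂ refl ∷ []
to-edge (inj₂ j)        = j , 0 , z≤n , []

walk-within : ∀ m (u v : Vtx (Middle (Path (suc m)))) → ∃[ k ] (k ≤ suc m × Walk (Middle (Path (suc m))) u v k)
walk-within zero    (inj₁ fzero) (inj₁ fzero) = 0 , z≤n , []
walk-within (suc m) u v with to-edge u | to-edge v
... | j , l , l≤1 , p | j′ , l′ , l′≤1 , p′ with edges-walk j j′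
... | k , k≤m , q = l + (k + l′) , length≤ , p ++ʷ (q ++ʷ Middle-reverse p′)
  where
  length≤ : l + (k + l′) ≤ suc (suc m)
  length≤ = subst (l + (k + l′) ≤_) (cong suc (+-comm m 1)) (+-mono-≤ l≤1 (+-mono-≤ k≤m l′≤1))

Middle-Path-diam≤ : ∀ m {D} → IsDiam (Middle (Path (suc m))) D → D ≤ suc m
Middle-Path-diam≤ m = diam≤ (walk-within m)

module Labeling (m : ℕ) where

  private
    G : Graph
    G = Middle (Path (suc m))

  visit : ℕ → ℕ
  visit 0 = m
  visit 1 = suc m
  visit 2 = 0
  visit (suc (suc (suc t))) = suc (visit (suc t))

  visit-low : ∀ p → visit (suc (suc (2 * p))) ≡ p
  visit-low zero    = refl
  visit-low (suc p) = trans (cong (visit ∘ suc ∘ suc) (*-suc 2 p)) (cong suc (visit-low p))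

  visit-high : ∀ r → visit (suc (2 * r)) ≡ suc (m + r)
  visit-high zero    = cong suc (sym (+-identityʳ m))
  visit-high (suc r) = trans (cong (visit ∘ suc) (*-suc 2 r)) (cong suc (trans (visit-high r) (sym (+-suc m r))))

  index : ℕ → ℕ
  index p with compare p m
  ... | less .p k    = suc (suc (2 * p))
  ... | equal .m     = 0
  ... | greater .m r = suc (2 * r)

  visit-index : ∀ p → visit (index p) ≡ p
  visit-index p with compare p m
  ... | less .p k    = visit-low p
  ... | equal .m     = refl
  ... | greater .m r = visit-high r

  index-≤ : ∀ p → p ≤ 2 * m → index p ≤ 2 * m
  index-≤ p p≤2m with compare p m
  ... | less .p k    = subst (_≤ 2 * suc (p + k)) (*-suc 2 p) (*-monoʳ-≤ 2 (s≤s (m≤m+n p k)))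
  ... | equal .m     = z≤n
  ... | greater .m r = ≤-trans (n≤1+n _) (subst (_≤ 2 * m) (*-suc 2 r) (*-monoʳ-≤ 2 r<m))
    where
    r<m : suc r ≤ m
    r<m = +-cancelˡ-≤ m (suc r) m (subst₂ _≤_ (sym (+-suc m r)) (cong (m +_) (+-identityʳ m)) p≤2m)

  pos-≤ : ∀ (u : Vtx G) → pos u ≤ 2 * m
  pos-≤ (inj₁ i) = *-monoʳ-≤ 2 (toℕ≤pred[n] i)
  pos-≤ (inj₂ j) = ≤-trans (n≤1+n _) (subst (_≤ 2 * m) (*-suc 2 (toℕ j)) (*-monoʳ-≤ 2 (toℕ<n j)))

  ord : Vtx G → ℕ
  ord = index ∘ pos

  ord-injective : ∀ {u v} → ord u ≡ ord v → u ≡ v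
  ord-injective {u} {v} eq = pos-injective (trans (sym (visit-index (pos u))) (trans (cong visit eq) (visit-index (pos v))))

  gaps : (ℕ → ℕ) → ℕ → ℕ
  gaps h 0       = suc m
  gaps h (suc t) = h t

  partialSum-gaps : ∀ h t → partialSum (gaps h) (suc t) ≡ suc m + partialSum h t
  partialSum-gaps h = partialSum-+ (gaps h) 1

  StepCheck : (ℕ → ℕ) → ℕ → Set
  StepCheck h t = ∀ ℓ → ∣ visit t - visit (suc t) ∣ + evenBit (visit t) + evenBit (visit (suc t)) ≤ suc ℓ * 2 →
                  suc m + 1 ≤ gaps h t + suc ℓ

  rn-Middle-Path : (h : ℕ → ℕ) → (∀ t → suc m ≤ h t + h (suc t)) → (∀ t → StepCheck h (suc t)) →
                   RnAtMost G (partialSum (gaps h) (2 * m))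
  rn-Middle-Path h pair step = partialSum (gaps h) ∘ ord , radio , span
    where
    gap-pair : ∀ t → suc m ≤ gaps h t + gaps h (suc t)
    gap-pair zero    = m≤m+n (suc m) (h 0)
    gap-pair (suc t) = pair t

    step-all : ∀ t → StepCheck h t
    step-all zero    ℓ _ = +-monoʳ-≤ (suc m) (s≤s z≤n)
    step-all (suc t) = step t

    gap-step : ∀ {u v k} → suc (ord u) ≡ ord v → Walk G u v (suc k) → suc m + 1 ≤ gaps h (ord u) + suc k
    gap-step {u} {v} {k} next p =
      step-all (ord u) k
        (subst₂ (λ x y → ∣ x - y ∣ + evenBit x + evenBit y ≤ suc k * 2)
          (sym (visit-index (pos u))) (trans (sym (visit-index (pos v))) (cong visit (sym next)))
          (walk-bound pos (evenBit ∘ pos) (λ {u} {v} → adj-pos-bound {u = u} {v = v}) p))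

    radio : IsRadioLabeling G (partialSum (gaps h) ∘ ord)
    radio = radio-from-ordering (λ {u} {v} → Middle-adj-sym (Path (suc m)) {u} {v}) (Middle-Path-diam≤ m)
                                ord ord-injective (gaps h) gap-pair gap-step

    span : SpanAtMost G (partialSum (gaps h) ∘ ord) (partialSum (gaps h) (2 * m))
    span u v = ∣partialSum-partialSum∣≤ (gaps h) (index-≤ (pos u) (pos-≤ u)) (index-≤ (pos v) (pos-≤ v))

module _ (k : ℕ) where
  open Labeling (suc (2 * k))

  even-gaps : ℕ → ℕ
  even-gaps = cycle₄ (suc k) (suc k) (suc (suc k)) (suc k)

  even-pair : ∀ t → suc (suc (2 * k)) ≤ even-gaps t + even-gaps (suc t)
  even-pair = cycle₄-pair≥ n≤2K (≤-trans n≤2K (+-monoʳ-≤ (suc k) (n≤1+n _))) (≤-trans n≤2K (n≤1+n _)) n≤2K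
    where
    n≤2K : suc (suc (2 * k)) ≤ suc k + suc k
    n≤2K = ≤-reflexive (solve [ k ])

  -- In each case the second argument of half-≤ is 2 d(visit t, visit (t+1)).
  even-step : ∀ t → StepCheck even-gaps (suc t)
  even-step 0 ℓ B≤ rewrite evenBit-even k = half-≤ (suc k) (suc (suc (2 * k)) + 1 + 1) (solve [ k ]) B≤
  even-step 1 ℓ B≤ rewrite evenBit-odd k = half-≤ (suc k) (suc (suc (suc (2 * k))) + 1 + 0) (solve [ k ]) B≤
  even-step 2 ℓ B≤ rewrite evenBit-odd k = half-≤ (suc (suc k)) (suc (suc (2 * k)) + 0 + 0) (solve [ k ]) B≤
  even-step 3 ℓ B≤ rewrite evenBit-even k = half-≤ (suc k) (suc (suc (suc (2 * k))) + 0 + 1) (solve [ k ]) B≤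
  even-step (suc (suc (suc (suc t)))) = even-step t

  even-span : partialSum (gaps even-gaps) (2 * suc (2 * k)) ≡ 4 * suc k * suc k ∸ 1
  even-span = begin
    partialSum (gaps even-gaps) (2 * suc (2 * k))                       ≡⟨ cong (partialSum (gaps even-gaps)) length≡ ⟩
    partialSum (gaps even-gaps) (suc (k * 4 + 1))                       ≡⟨ partialSum-gaps even-gaps (k * 4 + 1) ⟩
    suc (suc (2 * k)) + partialSum even-gaps (k * 4 + 1)                ≡⟨ cong (suc (suc (2 * k)) +_) (partialSum-cycle₄ _ _ _ _ k 1) ⟩
    suc (suc (2 * k)) + (k * (suc k + suc k + suc (suc k) + suc k) + suc k) ≡⟨ cong (_∸ 1) square ⟩
    4 * suc k * suc k ∸ 1                                                ∎
    where
    open ≡-Reasoning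
    length≡ : 2 * suc (2 * k) ≡ suc (k * 4 + 1)
    length≡ = solve [ k ]
    square : suc (suc (suc (2 * k)) + (k * (suc k + suc k + suc (suc k) + suc k) + suc k)) ≡ 4 * suc k * suc k
    square = solve [ k ]

  rn-even : RnAtMost (Middle (Path (suc (suc (2 * k))))) (4 * suc k * suc k ∸ 1)
  rn-even = subst (RnAtMost (Middle (Path (suc (suc (2 * k)))))) even-span (rn-Middle-Path even-gaps even-pair even-step)

module _ (k : ℕ) where
  open Labeling (2 * k)

  odd-gaps : ℕ → ℕ
  odd-gaps = cycle₄ (suc k) k (suc k) (suc k)

  odd-pair : ∀ t → suc (2 * k) ≤ odd-gaps t + odd-gaps (suc t)
  odd-pair = cycle₄-pair≥ n≤2K+1 (≤-trans n≤2K+1 (≤-reflexive (sym (+-suc k k))))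
                          (≤-trans n≤2K+1 (+-monoʳ-≤ (suc k) (n≤1+n k))) (≤-trans n≤2K+1 (+-monoʳ-≤ (suc k) (n≤1+n k)))
    where
    n≤2K+1 : suc (2 * k) ≤ suc k + k
    n≤2K+1 = ≤-reflexive (solve [ k ])

  odd-step : ∀ t → StepCheck odd-gaps (suc t)
  odd-step 0 ℓ B≤ rewrite evenBit-odd k = half-≤ (suc k) (suc (2 * k) + 0 + 1) (solve [ k ]) B≤
  odd-step 1 ℓ B≤ rewrite evenBit-even k = half-≤ k (suc (suc (2 * k)) + 1 + 1) (solve [ k ]) B≤
  odd-step 2 ℓ B≤ rewrite evenBit-even k = half-≤ (suc k) (suc (2 * k) + 1 + 0) (solve [ k ]) B≤
  odd-step 3 ℓ B≤ rewrite evenBit-odd k = half-≤ (suc k) (suc (suc (2 * k)) + 0 + 0) (solve [ k ]) B≤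
  odd-step (suc (suc (suc (suc t)))) = odd-step t

odd-span : ∀ k → partialSum (Labeling.gaps (2 * k) (odd-gaps k)) (2 * (2 * k)) ≡ 4 * k * (k + 1)
odd-span zero    = refl
odd-span (suc k) = begin
  partialSum (gaps (odd-gaps (suc k))) (2 * (2 * suc k))                    ≡⟨ cong (partialSum (gaps (odd-gaps (suc k)))) length≡ ⟩
  partialSum (gaps (odd-gaps (suc k))) (suc (k * 4 + 3))                    ≡⟨ partialSum-gaps (odd-gaps (suc k)) (k * 4 + 3) ⟩
  suc (2 * suc k) + partialSum (odd-gaps (suc k)) (k * 4 + 3)               ≡⟨ cong (suc (2 * suc k) +_) (partialSum-cycle₄ _ _ _ _ k 3) ⟩
  suc (2 * suc k) + (k * (suc (suc k) + suc k + suc (suc k) + suc (suc k))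
                     + (suc (suc k) + suc k + suc (suc k)))                 ≡⟨ solve [ k ] ⟩
  4 * suc k * (suc k + 1)                                                    ∎
  where
  open Labeling (2 * suc k)
  open ≡-Reasoning
  length≡ : 2 * (2 * suc k) ≡ suc (k * 4 + 3)
  length≡ = solve [ k ]

rn-odd : ∀ k → RnAtMost (Middle (Path (suc (2 * k)))) (4 * k * (k + 1))
rn-odd k = subst (RnAtMost (Middle (Path (suc (2 * k))))) (odd-span k)
                 (Labeling.rn-Middle-Path (2 * k) (odd-gaps k) (odd-pair k) (odd-step k))

even-case : ∀ {n} k → 1 ≤ n → n ≡ 2 * k → RnAtMost (Middle (Path n)) (4 * k * k ∸ 1)
even-case (suc k) _ refl = subst (λ n → RnAtMost (Middle (Path n)) (4 * suc k * suc k ∸ 1)) (sym (*-suc 2 k)) (rn-even k)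

odd-case : ∀ {n} k → n ≡ 2 * k + 1 → RnAtMost (Middle (Path n)) (4 * k * (k + 1))
odd-case k refl = subst (λ n → RnAtMost (Middle (Path n)) (4 * k * (k + 1))) (+-comm 1 (2 * k)) (rn-odd k)

mainTheorem3 : ∀ (n : ℕ) → 1 ≤ n → ∀ (k : ℕ) →
    (n ≡ 2 * k → RnAtMost (Middle (Path n)) (4 * k * k ∸ 1))
    × (n ≡ 2 * k + 1 → RnAtMost (Middle (Path n)) (4 * k * (k + 1)))
mainTheorem3 n 1≤n k = even-case k 1≤n , odd-case k
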